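{- Let $K$ be a quadratic field with ring of integers $\mathcal{O}_K$. For every $x\in\mathcal{O}_K$, $E(x)\in\{1,2,3,4,6,\infty\}$.
   Context: For $x\in\mathcal{O}_K$: if there is a positive integer $t$ with $x^t\in\mathbb{Z}$, the exponent $E(x)$ is the smallest such positive integer $t$ (and $x$ is said to have finite exponent); otherwise $E(x)=\infty$. -}

module Defs where

open import Data.Nat as ℕ using (ℕ; zero; suc)
open import Data.Nat.Divisibility using (_∣_)
open import Data.Integer as ℤ using (ℤ; +_; ∣_∣)
open import Data.Rational as ℚ using (ℚ; _/_; 0ℚ; 1ℚ)
open import Data.List using (List; []; _∷_; _++_; [_])
open import Data.Product using (Σ; _×_; _,_; ∃)
open import Relation.Binary.PropositionalEquality using (_≡_)
open import Relation.Nullary using (¬_)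

-- d is a squarefree integer: the only natural n with n² ∣ d is n = 1
-- (this excludes d = 0, since 2² ∣ 0).
SquareFree : ℤ → Set
SquareFree d = ∀ (n : ℕ) → (n ℕ.* n) ∣ ∣ d ∣ → n ≡ 1

-- K = ℚ(√d) for squarefree d ≠ 1 (every quadratic field arises this way).
-- An element a + b√d is represented by the pair (a , b) of rationals.
K : Set
K = ℚ × ℚ

module Field (d : ℤ) where

  embedℚ : ℚ → K
  embedℚ a = (a , 0ℚ)

  embedℤ : ℤ → K
  embedℤ z = embedℚ (z / 1)

  0K 1K : K
  0K = embedℚ 0ℚ
  1K = embedℚ 1ℚ

  _+K_ : K → K → K
  (a , b) +K (c , e) = (a ℚ.+ c , b ℚ.+ e)

  -- (a + b√d)(c + e√d) = (ac + d·be) + (ae + bc)√d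
  _*K_ : K → K → K
  (a , b) *K (c , e) = (a ℚ.* c ℚ.+ (d / 1) ℚ.* (b ℚ.* e) , a ℚ.* e ℚ.+ b ℚ.* c)

  _^K_ : K → ℕ → K
  x ^K zero    = 1K
  x ^K (suc n) = x *K (x ^K n)

  -- evaluation of the integer polynomial c₀ + c₁X + … + cₙXⁿ (coefficient list c₀ ∷ … ∷ cₙ)
  evalPoly : List ℤ → K → K
  evalPoly []       x = 0K
  evalPoly (c ∷ cs) x = embedℤ c +K (x *K evalPoly cs x)

  InOK : K → Set
  InOK x = Σ (List ℤ) λ cs → evalPoly (cs ++ [ + 1 ]) x ≡ 0K

  IsRationalInteger : K → Set
  IsRationalInteger x = ∃ λ (z : ℤ) → x ≡ embedℤ z

  HasExponent : K → ℕ → Set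
  HasExponent x t = (0 ℕ.< t) × IsRationalInteger (x ^K t)
                    × (∀ s → 0 ℕ.< s → s ℕ.< t → ¬ IsRationalInteger (x ^K s))

{-# OPTIONS --safe #-}
module Submission where

-- Write x = (P + Q√d) / m over a common denominator m. Then mˢ xˢ = A s + B s √d with
-- (A s)² − d (B s)² = Nˢ and B s = Q · U s, where U is the Lucas sequence with trace T = 2P
-- and norm N = P² − dQ². If xᵗ ∈ ℤ then m²ᵗ ∣ (A t)² = Nᵗ, so m² ∣ N; and once m² ∣ N, xˢ is
-- an integer exactly when B s = 0. Hence E(x) = 1 if Q = 0, and otherwise E(x) is the first
-- zero of U. For T ≠ 0 and T² ≥ 4N the sequence U is positive up to sign, so it has no zero.
-- For T² < 4N, a zero Uₜ = 0 gives U₂ₜ = T · U(T² − 2N, N²)ₜ = 0, and reducing by the gcd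
-- (U(gT, g²N)ₛ = gˢ⁻¹ U(T, N)ₛ and Uₛ ≡ Tˢ⁻¹ mod N) yields N ∣ T². So T² = kN with k < 4,
-- and the first zero is at 2, 3, 4, 6 for k = 0, 1, 2, 3.

open import Defs
open import Data.Product using (∃; ∃₂; _×_; _,_; proj₁; proj₂)
open import Data.Sum using (_⊎_; inj₁; inj₂)
open import Data.Empty using (⊥-elim)
open import Data.List.Base using (_∷_; [])
open import Function using (_∘_)
open import Function.Bundles using (_⇔_; Equivalence; mk⇔)
open import Relation.Nullary using (¬_; yes; no; contradiction)
open import Relation.Binary.Definitions using (tri<; tri≈; tri>)
open import Relation.Binary.PropositionalEquality

module NatDivisibility where
  open import Data.Nat.Base
  open import Data.Nat.Properties using (_≟_; *-identityˡ; *-identityʳ; m^n≢0; *-commutativeSemigroup)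
  open import Data.Nat.Divisibility
  open import Data.Nat.DivMod using (_/_; m/n*n≡m)
  open import Data.Nat.GCD using (gcd; gcd[m,n]∣m; gcd[m,n]∣n; gcd[m,n]≡0⇒m≡0; gcd[m,n]≡0⇒n≡0)
  open import Data.Nat.Coprimality using (Coprime; coprime-divisor; coprime-/gcd)
  open import Algebra.Properties.CommutativeSemigroup *-commutativeSemigroup using (interchange)
  open ≡-Reasoning

  ^-distribʳ-* : ∀ m n k → (m * n) ^ k ≡ m ^ k * n ^ k
  ^-distribʳ-* m n zero    = refl
  ^-distribʳ-* m n (suc k) = begin
    m * n * (m * n) ^ k      ≡⟨ cong (m * n *_) (^-distribʳ-* m n k) ⟩
    m * n * (m ^ k * n ^ k)  ≡⟨ interchange m n (m ^ k) (n ^ k) ⟩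
    m * m ^ k * (n * n ^ k)  ∎

  ^-monoˡ-∣ : ∀ {m n} k → m ∣ n → m ^ k ∣ n ^ k
  ^-monoˡ-∣ zero    m∣n = ∣-refl
  ^-monoˡ-∣ (suc k) m∣n = *-pres-∣ m∣n (^-monoˡ-∣ k m∣n)

  coprime∧∣^⇒≡1 : ∀ {m n} k → Coprime m n → m ∣ n ^ k → m ≡ 1
  coprime∧∣^⇒≡1 zero    _       m∣1  = ∣1⇒≡1 m∣1
  coprime∧∣^⇒≡1 (suc k) coprime m∣nᵏ = coprime∧∣^⇒≡1 k coprime (coprime-divisor coprime m∣nᵏ)

  m^n∣o^n⇒m∣o : ∀ {m o} n → m ^ suc n ∣ o ^ suc n → m ∣ o
  m^n∣o^n⇒m∣o {m} {o} n mⁿ∣oⁿ with gcd m o ≟ 0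
  ... | yes g≡0 = subst₂ _∣_ (sym (gcd[m,n]≡0⇒m≡0 g≡0)) (sym (gcd[m,n]≡0⇒n≡0 m g≡0)) ∣-refl
  ... | no  g≢0 = subst (_∣ o) (sym m≡g) (gcd[m,n]∣n m o)
    where
      g = gcd m o
      instance
        _ = ≢-nonZero g≢0
        _ = m^n≢0 g (suc n)
      m≡m′g : m ≡ m / g * g
      m≡m′g = sym (m/n*n≡m (gcd[m,n]∣m m o))
      o≡o′g : o ≡ o / g * g
      o≡o′g = sym (m/n*n≡m (gcd[m,n]∣n m o))
      m′ⁿ∣o′ⁿ : (m / g) ^ suc n ∣ (o / g) ^ suc n
      m′ⁿ∣o′ⁿ = *-cancelʳ-∣ (g ^ suc n)
        (subst₂ _∣_ (trans (cong (_^ suc n) m≡m′g) (^-distribʳ-* (m / g) g (suc n)))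
                    (trans (cong (_^ suc n) o≡o′g) (^-distribʳ-* (o / g) g (suc n))) mⁿ∣oⁿ)
      m≡g : m ≡ g
      m≡g = begin
        m          ≡⟨ m≡m′g ⟩
        m / g * g  ≡⟨ cong (_* g) (coprime∧∣^⇒≡1 (suc n) (coprime-/gcd m o)
                                    (∣-trans (m∣m*n ((m / g) ^ n)) m′ⁿ∣o′ⁿ)) ⟩
        1 * g      ≡⟨ *-identityˡ g ⟩
        g          ∎

  m*m∣o*o⇒m∣o : ∀ {m o} → m * m ∣ o * o → m ∣ o
  m*m∣o*o⇒m∣o {m} {o} m²∣o² = m^n∣o^n⇒m∣o 1 (subst₂ _∣_ (square m) (square o) m²∣o²)
    where
      square : ∀ n → n * n ≡ n ^ 2
      square n = cong (n *_) (sym (*-identityʳ n))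

open NatDivisibility

open import Data.Nat.Base as ℕ using (ℕ; zero; suc; s≤s; z≤n)
import Data.Nat.Properties as ℕ
import Data.Nat.Divisibility as ℕ
open import Data.Nat.GCD as ℕ using (GCD; gcd-GCD; GCD-*)
open import Data.Nat.Coprimality using (GCD≡1⇒coprime)
open import Data.Integer.Base hiding (suc; pred)
open import Data.Integer.Properties
  using (_≟_; pos-*; abs-*; *-comm; *-assoc; *-identityˡ; *-identityʳ; *-zeroʳ; +-identityʳ;
         +-injective; i*j≡0⇒i≡0∨j≡0; i^n≡0⇒i≡0)
open import Data.Integer.Divisibility.Signed
open import Data.Integer.GCD using (gcd; gcd[i,j]∣i; gcd[i,j]∣j; gcd[i,j]≡0⇒i≡0)
open import Data.Integer.Coprimality using (Coprime)
import Data.Integer.Coprimality as Coprime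
open import Data.Integer.Tactic.RingSolver using (solve; solve-∀)
open import Data.Rational.Base using (ℚ; mkℚ; toℚᵘ; fromℚᵘ)
import Data.Rational.Base as ℚ
import Data.Rational.Properties as ℚ
open import Data.Rational.Unnormalised.Base using (mkℚᵘ; *≡*; _≃_; 0ℚᵘ)
import Data.Rational.Unnormalised.Base as ℚᵘ
import Data.Rational.Unnormalised.Properties as ℚᵘ
open ≡-Reasoning

private variable
  i j T N M : ℤ
  s t : ℕ

i*i≡+∣i∣*∣i∣ : ∀ i → i * i ≡ + (∣ i ∣ ℕ.* ∣ i ∣)
i*i≡+∣i∣*∣i∣ (+ n)    = sym (pos-* n n)
i*i≡+∣i∣*∣i∣ -[1+ n ] = refl

∣i^n∣≡∣i∣^n : ∀ i n → ∣ i ^ n ∣ ≡ ∣ i ∣ ℕ.^ n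
∣i^n∣≡∣i∣^n i zero    = refl
∣i^n∣≡∣i∣^n i (suc n) = trans (abs-* i (i ^ n)) (cong (∣ i ∣ ℕ.*_) (∣i^n∣≡∣i∣^n i n))

i*j≡0∧j≢0⇒i≡0 : j ≢ 0ℤ → i * j ≡ 0ℤ → i ≡ 0ℤ
i*j≡0∧j≢0⇒i≡0 {j} {i} j≢0 ij≡0 with i*j≡0⇒i≡0∨j≡0 i ij≡0
... | inj₁ i≡0 = i≡0
... | inj₂ j≡0 = ⊥-elim (j≢0 j≡0)

i≢0∧j≢0⇒i*j≢0 : i ≢ 0ℤ → j ≢ 0ℤ → i * j ≢ 0ℤ
i≢0∧j≢0⇒i*j≢0 i≢0 j≢0 ij≡0 = i≢0 (i*j≡0∧j≢0⇒i≡0 j≢0 ij≡0)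

coprime-quotients : ∀ i j → gcd i j ≢ 0ℤ →
                    ∃₂ λ i′ j′ → i ≡ i′ * gcd i j × j ≡ j′ * gcd i j × Coprime i′ j′
coprime-quotients i j g≢0 with ∣ᵤ⇒∣ (gcd[i,j]∣i i j) | ∣ᵤ⇒∣ (gcd[i,j]∣j i j)
... | divides i′ i≡i′g | divides j′ j≡j′g = i′ , j′ , i≡i′g , j≡j′g , GCD≡1⇒coprime (GCD-* scaled)
  where
    g = ℕ.gcd ∣ i ∣ ∣ j ∣
    instance _ = ≢-nonZero g≢0
    scaled : GCD (∣ i′ ∣ ℕ.* g) (∣ j′ ∣ ℕ.* g) (1 ℕ.* g)
    scaled = subst₂ (λ a b → GCD a b (1 ℕ.* g))
               (trans (cong ∣_∣ i≡i′g) (abs-* i′ (+ g))) (trans (cong ∣_∣ j≡j′g) (abs-* j′ (+ g)))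
               (subst (GCD ∣ i ∣ ∣ j ∣) (sym (ℕ.*-identityˡ g)) (gcd-GCD ∣ i ∣ ∣ j ∣))

IsLeastPositive : (ℕ → Set) → ℕ → Set
IsLeastPositive P t = 0 ℕ.< t × P t × (∀ s → 0 ℕ.< s → s ℕ.< t → ¬ P s)

least-unique : ∀ {P : ℕ → Set} {t u} → IsLeastPositive P t → IsLeastPositive P u → t ≡ u
least-unique {t = t} {u} (0<t , Pt , t-least) (0<u , Pu , u-least) with ℕ.<-cmp t u
... | tri< t<u _ _ = contradiction Pt (u-least t 0<t t<u)
... | tri≈ _ t≡u _ = t≡u
... | tri> _ _ u<t = contradiction Pu (t-least u 0<u u<t)

least-transfer : ∀ {P Q : ℕ → Set} {t} → (∀ s → P s ⇔ Q s) → IsLeastPositive P t → IsLeastPositive Q t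
least-transfer P⇔Q (0<t , Pt , t-least) =
  0<t , Equivalence.to (P⇔Q _) Pt , λ s 0<s s<t → t-least s 0<s s<t ∘ Equivalence.from (P⇔Q s)

-- Lucas sequences

U : ℤ → ℤ → ℕ → ℤ
U T N zero          = 0ℤ
U T N (suc zero)    = 1ℤ
U T N (suc (suc s)) = T * U T N (suc s) - N * U T N s

IsFirstZero : ℤ → ℤ → ℕ → Set
IsFirstZero T N = IsLeastPositive (λ s → U T N s ≡ 0ℤ)

U₂ : ∀ T N → U T N 2 ≡ T
U₂ T N = begin T * 1ℤ - N * 0ℤ ≡⟨ solve (T ∷ N ∷ []) ⟩ T ∎

recurrence⇒≡U* : ∀ T N {f : ℕ → ℤ} → (∀ s → f (suc (suc s)) ≡ T * f (suc s) - N * f s) →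
                 f 0 ≡ 0ℤ → ∀ s → f s ≡ U T N s * f 1
recurrence⇒≡U* T N {f} recurrence f₀≡0 = go
  where
    distrib : ∀ u₁ u₀ c → T * (u₁ * c) - N * (u₀ * c) ≡ (T * u₁ - N * u₀) * c
    distrib u₁ u₀ c = solve (T ∷ N ∷ u₁ ∷ u₀ ∷ c ∷ [])
    go : ∀ s → f s ≡ U T N s * f 1
    go zero          = f₀≡0
    go (suc zero)    = sym (*-identityˡ (f 1))
    go (suc (suc s)) = begin
      f (suc (suc s))                                  ≡⟨ recurrence s ⟩
      T * f (suc s) - N * f s                          ≡⟨ cong₂ (λ x y → T * x - N * y) (go (suc s)) (go s) ⟩
      T * (U T N (suc s) * f 1) - N * (U T N s * f 1)  ≡⟨ distrib (U T N (suc s)) (U T N s) (f 1) ⟩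
      U T N (suc (suc s)) * f 1                        ∎

U-shift : U T N t ≡ 0ℤ → ∀ s → U T N (s ℕ.+ t) ≡ U T N s * U T N (suc t)
U-shift {T} {N} Uₜ≡0 = recurrence⇒≡U* T N (λ _ → refl) Uₜ≡0

U-double : ∀ t → U T N t ≡ 0ℤ → U T N (t ℕ.* 2) ≡ 0ℤ
U-double {T} {N} t Uₜ≡0 = begin
  U T N (t ℕ.* 2)          ≡⟨ cong (U T N) (trans (ℕ.*-comm t 2) (cong (t ℕ.+_) (ℕ.+-identityʳ t))) ⟩
  U T N (t ℕ.+ t)          ≡⟨ U-shift Uₜ≡0 t ⟩
  U T N t * U T N (suc t)  ≡⟨ cong (_* U T N (suc t)) Uₜ≡0 ⟩
  0ℤ                       ∎

-- U (T² − 2N) (N²) is the Lucas sequence of the squares α², β² of the roots of X² − TX + N.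
U-even : ∀ T N s → U T N (s ℕ.* 2) ≡ U (T * T - + 2 * N) (N * N) s * T
U-even T N s = begin
  U T N (s ℕ.* 2)                               ≡⟨ recurrence⇒≡U* (T * T - + 2 * N) (N * N) recurrence refl s ⟩
  U (T * T - + 2 * N) (N * N) s * U T N 2       ≡⟨ cong (U (T * T - + 2 * N) (N * N) s *_) (U₂ T N) ⟩
  U (T * T - + 2 * N) (N * N) s * T             ∎
  where
    step : ∀ u₁ u₀ → T * (T * (T * u₁ - N * u₀) - N * u₁) - N * (T * u₁ - N * u₀)
                   ≡ (T * T - + 2 * N) * (T * u₁ - N * u₀) - N * N * u₀
    step u₁ u₀ = solve (T ∷ N ∷ u₁ ∷ u₀ ∷ [])
    recurrence : ∀ s → U T N (suc (suc s) ℕ.* 2)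
                     ≡ (T * T - + 2 * N) * U T N (suc s ℕ.* 2) - N * N * U T N (s ℕ.* 2)
    recurrence s = step (U T N (suc (s ℕ.* 2))) (U T N (s ℕ.* 2))

U-homogeneous : ∀ g T N s → U (g * T) (g * g * N) s * g ≡ U T N s * g ^ s
U-homogeneous g T N s = begin
  U (g * T) (g * g * N) s * g                  ≡⟨ cong (U (g * T) (g * g * N) s *_) g≡U₁*g¹ ⟩
  U (g * T) (g * g * N) s * (U T N 1 * g ^ 1)  ≡⟨ recurrence⇒≡U* (g * T) (g * g * N) recurrence refl s ⟨
  U T N s * g ^ s                              ∎
  where
    g≡U₁*g¹ : g ≡ 1ℤ * (g * 1ℤ)
    g≡U₁*g¹ = solve (g ∷ [])
    step : ∀ u₁ u₀ e → (T * u₁ - N * u₀) * (g * (g * e)) ≡ g * T * (u₁ * (g * e)) - g * g * N * (u₀ * e)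
    step u₁ u₀ e = solve (g ∷ T ∷ N ∷ u₁ ∷ u₀ ∷ e ∷ [])
    recurrence : ∀ s → U T N (suc (suc s)) * g ^ suc (suc s)
                     ≡ g * T * (U T N (suc s) * g ^ suc s) - g * g * N * (U T N s * g ^ s)
    recurrence s = step (U T N (suc s)) (U T N s) (g ^ s)

U-negate : ∀ T N s → U (- T) N s * -1ℤ ≡ U T N s * -1ℤ ^ s
U-negate T N s = sym (recurrence⇒≡U* (- T) N recurrence refl s)
  where
    step : ∀ u₁ u₀ e → (T * u₁ - N * u₀) * (-1ℤ * (-1ℤ * e)) ≡ - T * (u₁ * (-1ℤ * e)) - N * (u₀ * e)
    step u₁ u₀ e = solve (T ∷ N ∷ u₁ ∷ u₀ ∷ e ∷ [])
    recurrence : ∀ s → U T N (suc (suc s)) * -1ℤ ^ suc (suc s)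
                     ≡ - T * (U T N (suc s) * -1ℤ ^ suc s) - N * (U T N s * -1ℤ ^ s)
    recurrence s = step (U T N (suc s)) (U T N s) (-1ℤ ^ s)

N∣T^s-U[1+s] : ∀ T N s → N ∣ T ^ s - U T N (suc s)
N∣T^s-U[1+s] T N zero    = divides 0ℤ refl
N∣T^s-U[1+s] T N (suc s) = subst (N ∣_) (step (T ^ s) (U T N (suc s)) (U T N s))
                             (∣m∣n⇒∣m+n (∣n⇒∣m*n T (N∣T^s-U[1+s] T N s)) (∣m⇒∣m*n (U T N s) ∣-refl))
  where
    step : ∀ e u₁ u₀ → T * (e - u₁) + N * u₀ ≡ T * e - (T * u₁ - N * u₀)
    step e u₁ u₀ = solve (T ∷ N ∷ e ∷ u₁ ∷ u₀ ∷ [])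

U-zero⇒∣M∣≡1 : ∀ t → Coprime T M → U T (M * M) (suc t) ≡ 0ℤ → ∣ M ∣ ≡ 1
U-zero⇒∣M∣≡1 {T} {M} t coprime U≡0 =
  coprime∧∣^⇒≡1 t (Coprime.sym {T} {M} coprime) (subst (ℕ._∣_ ∣ M ∣) (∣i^n∣≡∣i∣^n T t) (∣⇒∣ᵤ M∣Tᵗ))
  where
    M*M∣Tᵗ : M * M ∣ T ^ t
    M*M∣Tᵗ = subst (M * M ∣_) (trans (cong (_-_ (T ^ t)) U≡0) (+-identityʳ (T ^ t))) (N∣T^s-U[1+s] T (M * M) t)
    M∣Tᵗ : M ∣ T ^ t
    M∣Tᵗ = ∣-trans (∣m⇒∣m*n M ∣-refl) M*M∣Tᵗ

U-zero⇒M∣T : ∀ t → U T (M * M) (suc t) ≡ 0ℤ → M ∣ T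
U-zero⇒M∣T {T} {M} t U≡0 with gcd T M ≟ 0ℤ
... | yes g≡0 = subst (M ∣_) (sym (gcd[i,j]≡0⇒i≡0 T M g≡0)) (divides 0ℤ refl)
... | no  g≢0 with coprime-quotients T M g≢0
...   | T′ , M′ , T≡T′g , M≡M′g , coprime =
  ∣ᵤ⇒∣ (subst (ℕ._∣ ∣ T ∣) (sym ∣M∣≡∣g∣) (gcd[i,j]∣i T M))
  where
    g = gcd T M
    rearrange : ∀ m g → m * g * (m * g) ≡ g * g * (m * m)
    rearrange = solve-∀
    scaled : U (g * T′) (g * g * (M′ * M′)) (suc t) ≡ 0ℤ
    scaled = subst₂ (λ a b → U a b (suc t) ≡ 0ℤ)
               (trans T≡T′g (*-comm T′ g)) (trans (cong₂ _*_ M≡M′g M≡M′g) (rearrange M′ g)) U≡0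
    reduced : U T′ (M′ * M′) (suc t) ≡ 0ℤ
    reduced = i*j≡0∧j≢0⇒i≡0 (g≢0 ∘ i^n≡0⇒i≡0 g (suc t))
                (trans (sym (U-homogeneous g T′ (M′ * M′) (suc t))) (cong (_* g) scaled))
    ∣M∣≡∣g∣ : ∣ M ∣ ≡ ∣ g ∣
    ∣M∣≡∣g∣ = begin
      ∣ M ∣             ≡⟨ cong ∣_∣ M≡M′g ⟩
      ∣ M′ * g ∣        ≡⟨ abs-* M′ g ⟩
      ∣ M′ ∣ ℕ.* ∣ g ∣  ≡⟨ cong (ℕ._* ∣ g ∣) (U-zero⇒∣M∣≡1 {T′} {M′} t coprime reduced) ⟩
      1 ℕ.* ∣ g ∣       ≡⟨ ℕ.*-identityˡ ∣ g ∣ ⟩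
      ∣ g ∣             ∎

U-zero⇒N∣T² : ∀ t → U T N (suc t) ≡ 0ℤ → N ∣ T * T
U-zero⇒N∣T² {T} {N} t U≡0 with T ≟ 0ℤ
... | yes T≡0 = subst (λ x → N ∣ x * x) (sym T≡0) (divides 0ℤ refl)
... | no  T≢0 =
  ∣m+n∣n⇒∣m {m = T * T} (U-zero⇒M∣T t W≡0) (∣m⇒∣-m {m = + 2 * N} (∣n⇒∣m*n (+ 2) ∣-refl))
  where
    W≡0 : U (T * T - + 2 * N) (N * N) (suc t) ≡ 0ℤ
    W≡0 = i*j≡0∧j≢0⇒i≡0 T≢0 (trans (sym (U-even T N (suc t))) (U-double {T} {N} (suc t) U≡0))

U-positive : ∀ τ {N δ} → +[1+ τ ] * +[1+ τ ] - + 4 * N ≡ + δ →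
             ∀ s → ∃ λ u → U +[1+ τ ] N (suc s) ≡ +[1+ u ]
U-positive τ {N} {δ} disc s = proj₁ (invariant s)
  where
    halve : ∀ {i n} → + 2 * i ≡ +[1+ n ] → ∃ λ k → i ≡ +[1+ k ]
    halve {+[1+ k ]} _ = k , refl

    twice-next : ∀ {T u₂ u₁ u e} → u₁ ≡ +[1+ u ] → + 2 * u₂ - T * u₁ ≡ +[1+ e ] →
                 + 2 * u₂ ≡ +[1+ e ] + T * +[1+ u ]
    twice-next {T} {u₂} {u₁} {u} {e} u₁≡ e≡ = begin
      + 2 * u₂                      ≡⟨ solve (T ∷ u₂ ∷ u₁ ∷ []) ⟩
      (+ 2 * u₂ - T * u₁) + T * u₁  ≡⟨ cong₂ (λ x y → x + T * y) e≡ u₁≡ ⟩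
      +[1+ e ] + T * +[1+ u ]       ∎

    twice-excess : ∀ {T u₂ u₁ u e} → u₁ ≡ +[1+ u ] → + 2 * u₂ - T * u₁ ≡ +[1+ e ] →
                   T * T - + 4 * N ≡ + δ →
                   + 2 * (+ 2 * (T * u₂ - N * u₁) - T * u₂) ≡ T * +[1+ e ] + + (δ ℕ.* suc u)
    twice-excess {T} {u₂} {u₁} {u} {e} u₁≡ e≡ T²-4N≡δ = begin
      + 2 * (+ 2 * (T * u₂ - N * u₁) - T * u₂)          ≡⟨ solve (T ∷ N ∷ u₂ ∷ u₁ ∷ []) ⟩
      T * (+ 2 * u₂ - T * u₁) + (T * T - + 4 * N) * u₁  ≡⟨ cong₂ (λ x y → T * x + y * u₁) e≡ T²-4N≡δ ⟩
      T * +[1+ e ] + + δ * u₁                           ≡⟨ cong (λ z → T * +[1+ e ] + + δ * z) u₁≡ ⟩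
      T * +[1+ e ] + + δ * +[1+ u ]                     ≡⟨ cong (_+_ (T * +[1+ e ])) (pos-* δ (suc u)) ⟨
      T * +[1+ e ] + + (δ ℕ.* suc u)                    ∎

    invariant : ∀ s → (∃ λ u → U +[1+ τ ] N (suc s) ≡ +[1+ u ])
                    × (∃ λ e → + 2 * U +[1+ τ ] N (suc (suc s)) - +[1+ τ ] * U +[1+ τ ] N (suc s) ≡ +[1+ e ])
    invariant zero    = (0 , refl) , (τ , start +[1+ τ ] N)
      where
        start : ∀ T N → + 2 * (T * 1ℤ - N * 0ℤ) - T * 1ℤ ≡ T
        start = solve-∀
    invariant (suc s) with invariant s
    ... | (u , u₁≡) , (e , e≡) = halve (twice-next {+[1+ τ ]} u₁≡ e≡) ,
                                 halve (twice-excess {+[1+ τ ]} {U +[1+ τ ] N (suc (suc s))} u₁≡ e≡ disc)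

U-nonzero : ∀ {δ} → T ≢ 0ℤ → T * T - + 4 * N ≡ + δ → ∀ s → U T N (suc s) ≢ 0ℤ
U-nonzero {+0}       T≢0 _ _ _ = T≢0 refl
U-nonzero {+[1+ τ ]} _ disc s U≡0 with U-positive τ disc s
... | u , U≡1+u with trans (sym U≡1+u) U≡0
...   | ()
U-nonzero { -[1+ τ ]} {N} _ disc s U≡0 = U-nonzero {+[1+ τ ]} {N} (λ ()) disc s U₊≡0
  where
    U₊≡0 : U +[1+ τ ] N (suc s) ≡ 0ℤ
    U₊≡0 = i*j≡0∧j≢0⇒i≡0 ((λ ()) ∘ i^n≡0⇒i≡0 -1ℤ (suc s))
             (trans (sym (U-negate +[1+ τ ] N (suc s))) (cong (_* -1ℤ) U≡0))

4N≡T²+δ+1 : ∀ {δ} → T * T - + 4 * N ≡ -[1+ δ ] → + 4 * N ≡ + (∣ T ∣ ℕ.* ∣ T ∣ ℕ.+ suc δ)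
4N≡T²+δ+1 {T} {N} {δ} disc = begin
  + 4 * N                          ≡⟨ solve (T ∷ N ∷ []) ⟩
  T * T - (T * T - + 4 * N)        ≡⟨ cong₂ _-_ (i*i≡+∣i∣*∣i∣ T) disc ⟩
  + (∣ T ∣ ℕ.* ∣ T ∣) - -[1+ δ ]  ∎

T²∈[1,2,3]*N : ∀ {δ} → T ≢ 0ℤ → T * T - + 4 * N ≡ -[1+ δ ] → N ∣ T * T →
               T * T ≡ + 1 * N ⊎ T * T ≡ + 2 * N ⊎ T * T ≡ + 3 * N
T²∈[1,2,3]*N {T} {N@(-[1+ _ ])} _ disc _ with () ← 4N≡T²+δ+1 {T} {N} disc
T²∈[1,2,3]*N {T} {+ ν} {δ} T≢0 disc N∣T² with ∣⇒∣ᵤ N∣T²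
... | ℕ.divides k ∣T²∣≡kν = ratio k (ℕ.*-cancelʳ-< ν k 4 kν<4ν) T²≡kN
  where
    t² = ∣ T ∣ ℕ.* ∣ T ∣
    t²≡kν : t² ≡ k ℕ.* ν
    t²≡kν = trans (cong ∣_∣ (sym (i*i≡+∣i∣*∣i∣ T))) ∣T²∣≡kν
    kν<4ν : k ℕ.* ν ℕ.< 4 ℕ.* ν
    kν<4ν = subst₂ ℕ._<_ t²≡kν (+-injective (sym (trans (pos-* 4 ν) (4N≡T²+δ+1 {T} {+ ν} disc))))
                   (ℕ.m<m+n t² (s≤s z≤n))
    T²≡kN : T * T ≡ + k * + ν
    T²≡kN = trans (i*i≡+∣i∣*∣i∣ T) (trans (cong +_ t²≡kν) (pos-* k ν))
    ratio : ∀ k → k ℕ.< 4 → T * T ≡ + k * + ν →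
            T * T ≡ + 1 * + ν ⊎ T * T ≡ + 2 * + ν ⊎ T * T ≡ + 3 * + ν
    ratio 0 _ T²≡0  = contradiction (i*j≡0∧j≢0⇒i≡0 T≢0 T²≡0) T≢0
    ratio 1 _ T²≡N  = inj₁ T²≡N
    ratio 2 _ T²≡2N = inj₂ (inj₁ T²≡2N)
    ratio 3 _ T²≡3N = inj₂ (inj₂ T²≡3N)
    ratio (suc (suc (suc (suc _)))) (s≤s (s≤s (s≤s (s≤s ())))) _

-- For T² = kN the values U₃, U₄, U₆ vanish exactly at k = 1, 2, 3 (k = 4 cos² (π / s)).
module SquareRatio {T N : ℤ} (k : ℤ) (T²≡kN : T * T ≡ k * N) where

  U₃ : U T N 3 ≡ (k - 1ℤ) * N
  U₃ = begin
    T * U T N 2 - N * 1ℤ  ≡⟨ cong (λ u → T * u - N * 1ℤ) (U₂ T N) ⟩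
    T * T - N * 1ℤ        ≡⟨ cong (λ S → S - N * 1ℤ) T²≡kN ⟩
    k * N - N * 1ℤ        ≡⟨ solve (k ∷ N ∷ []) ⟩
    (k - 1ℤ) * N          ∎

  U₄ : U T N 4 ≡ (k - + 2) * (T * N)
  U₄ = begin
    T * U T N 3 - N * U T N 2   ≡⟨ cong₂ (λ u v → T * u - N * v) U₃ (U₂ T N) ⟩
    T * ((k - 1ℤ) * N) - N * T  ≡⟨ solve (T ∷ N ∷ k ∷ []) ⟩
    (k - + 2) * (T * N)         ∎

  U₅ : U T N 5 ≡ (k * k - + 3 * k + 1ℤ) * (N * N)
  U₅ = begin
    T * U T N 4 - N * U T N 3                       ≡⟨ cong₂ (λ u v → T * u - N * v) U₄ U₃ ⟩
    T * ((k - + 2) * (T * N)) - N * ((k - 1ℤ) * N)  ≡⟨ solve (T ∷ N ∷ k ∷ []) ⟩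
    (k - + 2) * N * (T * T) - N * ((k - 1ℤ) * N)    ≡⟨ cong (λ S → (k - + 2) * N * S - N * ((k - 1ℤ) * N))
                                                              T²≡kN ⟩
    (k - + 2) * N * (k * N) - N * ((k - 1ℤ) * N)    ≡⟨ solve (N ∷ k ∷ []) ⟩
    (k * k - + 3 * k + 1ℤ) * (N * N)                ∎

  U₆ : U T N 6 ≡ (k - 1ℤ) * (k - + 3) * (T * (N * N))
  U₆ = begin
    T * U T N 5 - N * U T N 4                                           ≡⟨ cong₂ (λ u v → T * u - N * v) U₅ U₄ ⟩
    T * ((k * k - + 3 * k + 1ℤ) * (N * N)) - N * ((k - + 2) * (T * N))  ≡⟨ solve (T ∷ N ∷ k ∷ []) ⟩
    (k - 1ℤ) * (k - + 3) * (T * (N * N))                                ∎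

  N≢0 : T ≢ 0ℤ → N ≢ 0ℤ
  N≢0 T≢0 N≡0 = T≢0 (i*j≡0∧j≢0⇒i≡0 T≢0 (trans T²≡kN (trans (cong (k *_) N≡0) (*-zeroʳ k))))

firstZero-2 : T ≡ 0ℤ → IsFirstZero T N 2
firstZero-2 {T} {N} T≡0 = s≤s z≤n , trans (U₂ T N) T≡0 , below
  where
    below : ∀ s → 0 ℕ.< s → s ℕ.< 2 → U T N s ≢ 0ℤ
    below 1 _ _ ()
    below (suc (suc _)) _ (s≤s (s≤s ()))

firstZero-3 : T ≢ 0ℤ → T * T ≡ + 1 * N → IsFirstZero T N 3
firstZero-3 {T} {N} T≢0 T²≡N = s≤s z≤n , U₃ , below
  where
    open SquareRatio {T} {N} (+ 1) T²≡N
    below : ∀ s → 0 ℕ.< s → s ℕ.< 3 → U T N s ≢ 0ℤ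
    below 1 _ _ ()
    below 2 _ _ = T≢0 ∘ trans (sym (U₂ T N))
    below (suc (suc (suc _))) _ (s≤s (s≤s (s≤s ())))

firstZero-4 : T ≢ 0ℤ → T * T ≡ + 2 * N → IsFirstZero T N 4
firstZero-4 {T} {N} T≢0 T²≡2N = s≤s z≤n , U₄ , below
  where
    open SquareRatio {T} {N} (+ 2) T²≡2N
    below : ∀ s → 0 ℕ.< s → s ℕ.< 4 → U T N s ≢ 0ℤ
    below 1 _ _ ()
    below 2 _ _ = T≢0 ∘ trans (sym (U₂ T N))
    below 3 _ _ = i≢0∧j≢0⇒i*j≢0 {1ℤ} (λ ()) (N≢0 T≢0) ∘ trans (sym U₃)
    below (suc (suc (suc (suc _)))) _ (s≤s (s≤s (s≤s (s≤s ()))))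

firstZero-6 : T ≢ 0ℤ → T * T ≡ + 3 * N → IsFirstZero T N 6
firstZero-6 {T} {N} T≢0 T²≡3N = s≤s z≤n , U₆ , below
  where
    open SquareRatio {T} {N} (+ 3) T²≡3N
    below : ∀ s → 0 ℕ.< s → s ℕ.< 6 → U T N s ≢ 0ℤ
    below 1 _ _ ()
    below 2 _ _ = T≢0 ∘ trans (sym (U₂ T N))
    below 3 _ _ = i≢0∧j≢0⇒i*j≢0 {+ 2} (λ ()) (N≢0 T≢0) ∘ trans (sym U₃)
    below 4 _ _ = i≢0∧j≢0⇒i*j≢0 {1ℤ} (λ ()) (i≢0∧j≢0⇒i*j≢0 T≢0 (N≢0 T≢0)) ∘ trans (sym U₄)
    below 5 _ _ = i≢0∧j≢0⇒i*j≢0 {1ℤ} (λ ()) (i≢0∧j≢0⇒i*j≢0 (N≢0 T≢0) (N≢0 T≢0)) ∘ trans (sym U₅)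
    below (suc (suc (suc (suc (suc (suc _)))))) _ (s≤s (s≤s (s≤s (s≤s (s≤s (s≤s ()))))))

firstZero∈[2,3,4,6] : IsFirstZero T N t → t ≡ 2 ⊎ t ≡ 3 ⊎ t ≡ 4 ⊎ t ≡ 6
firstZero∈[2,3,4,6] {T} {N} {suc t} first@(_ , U≡0 , _) with T ≟ 0ℤ | T * T - + 4 * N in disc
... | yes T≡0 | _        = inj₁ (least-unique first (firstZero-2 T≡0))
... | no  T≢0 | + _      = contradiction U≡0 (U-nonzero T≢0 disc t)
... | no  T≢0 | -[1+ _ ] with T²∈[1,2,3]*N T≢0 disc (U-zero⇒N∣T² {T} t U≡0)
...   | inj₁ T²≡N         = inj₂ (inj₁ (least-unique first (firstZero-3 T≢0 T²≡N)))
...   | inj₂ (inj₁ T²≡2N) = inj₂ (inj₂ (inj₁ (least-unique first (firstZero-4 T≢0 T²≡2N))))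
...   | inj₂ (inj₂ T²≡3N) = inj₂ (inj₂ (inj₂ (least-unique first (firstZero-6 T≢0 T²≡3N))))

-- Coordinates of powers in K

mkℚᵘ-+ : ∀ X Y k → mkℚᵘ X k ℚᵘ.+ mkℚᵘ Y k ≃ mkℚᵘ (X + Y) k
mkℚᵘ-+ X Y k = *≡* (identity X Y +[1+ k ])
  where
    identity : ∀ X Y S → (X * S + Y * S) * S ≡ (X + Y) * (S * S)
    identity = solve-∀

mkℚᵘ-*-integer : ∀ c Y k → mkℚᵘ c 0 ℚᵘ.* mkℚᵘ Y k ≃ mkℚᵘ (c * Y) k
mkℚᵘ-*-integer c Y k = *≡* (cong (λ n → c * Y * +[1+ n ]) (sym (ℕ.+-identityʳ k)))

mkℚᵘ≃integer⇔ : ∀ {X z k} → mkℚᵘ X k ≃ mkℚᵘ z 0 ⇔ X ≡ z * +[1+ k ]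
mkℚᵘ≃integer⇔ {X} = mk⇔ (λ { (*≡* eq) → trans (sym (*-identityʳ X)) eq })
                         (λ eq → *≡* (trans (*-identityʳ X) eq))

toℚᵘ-+-≃ : ∀ {p q u v} → toℚᵘ p ≃ u → toℚᵘ q ≃ v → toℚᵘ (p ℚ.+ q) ≃ u ℚᵘ.+ v
toℚᵘ-+-≃ {p} {q} p≃u q≃v = ℚᵘ.≃-trans (ℚ.toℚᵘ-homo-+ p q) (ℚᵘ.+-cong p≃u q≃v)

toℚᵘ-*-≃ : ∀ {p q u v} → toℚᵘ p ≃ u → toℚᵘ q ≃ v → toℚᵘ (p ℚ.* q) ≃ u ℚᵘ.* v
toℚᵘ-*-≃ {p} {q} p≃u q≃v = ℚᵘ.≃-trans (ℚ.toℚᵘ-homo-* p q) (ℚᵘ.*-cong p≃u q≃v)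

commonDenominator : ∀ a b → ∃₂ λ P Q → ∃ λ m′ → toℚᵘ a ≃ mkℚᵘ P m′ × toℚᵘ b ≃ mkℚᵘ Q m′
commonDenominator (mkℚ p j _) (mkℚ q k _) =
  p * +[1+ k ] , q * +[1+ j ] , k ℕ.+ j ℕ.* suc k ,
  *≡* (trans (cong (p *_) (pos-* (suc j) (suc k))) (swap p +[1+ j ] +[1+ k ])) ,
  *≡* (trans (cong (q *_) (pos-* (suc j) (suc k))) (sym (*-assoc q +[1+ j ] +[1+ k ])))
  where
    swap : ∀ p J K → p * (J * K) ≡ p * K * J
    swap = solve-∀

module _ (d : ℤ) where
  open Field d

  isRationalInteger⇔ : ∀ {x} → IsRationalInteger x ⇔
                       ∃ λ z → toℚᵘ (proj₁ x) ≃ mkℚᵘ z 0 × toℚᵘ (proj₂ x) ≃ 0ℚᵘ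
  isRationalInteger⇔ = mk⇔
    (λ { (z , refl) → z , ℚ.toℚᵘ-fromℚᵘ (mkℚᵘ z 0) , ℚᵘ.≃-refl })
    (λ (z , u≃z , v≃0) → z , cong₂ _,_ (≡fromℚᵘ u≃z) (≡fromℚᵘ v≃0))
    where
      ≡fromℚᵘ : ∀ {p w} → toℚᵘ p ≃ w → p ≡ fromℚᵘ w
      ≡fromℚᵘ {p} p≃w = trans (sym (ℚ.fromℚᵘ-toℚᵘ p)) (ℚ.fromℚᵘ-cong p≃w)

  *K-≃ : ∀ {a b c e P Q X Y j k} →
         toℚᵘ a ≃ mkℚᵘ P j → toℚᵘ b ≃ mkℚᵘ Q j → toℚᵘ c ≃ mkℚᵘ X k → toℚᵘ e ≃ mkℚᵘ Y k →
         toℚᵘ (proj₁ ((a , b) *K (c , e))) ≃ mkℚᵘ (P * X + d * (Q * Y)) (k ℕ.+ j ℕ.* suc k)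
       × toℚᵘ (proj₂ ((a , b) *K (c , e))) ≃ mkℚᵘ (P * Y + Q * X) (k ℕ.+ j ℕ.* suc k)
  *K-≃ {P = P} {Q} {X} {Y} {j} {k} a≃ b≃ c≃ e≃ =
    ℚᵘ.≃-trans (toℚᵘ-+-≃ (toℚᵘ-*-≃ a≃ c≃) (toℚᵘ-*-≃ d≃ (toℚᵘ-*-≃ b≃ e≃)))
      (ℚᵘ.≃-trans (ℚᵘ.+-congʳ (mkℚᵘ (P * X) n) (mkℚᵘ-*-integer d (Q * Y) n))
                  (mkℚᵘ-+ (P * X) (d * (Q * Y)) n)) ,
    ℚᵘ.≃-trans (toℚᵘ-+-≃ (toℚᵘ-*-≃ a≃ e≃) (toℚᵘ-*-≃ b≃ c≃)) (mkℚᵘ-+ (P * Y) (Q * X) n)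
    where
      n = k ℕ.+ j ℕ.* suc k
      d≃ : toℚᵘ (d ℚ./ 1) ≃ mkℚᵘ d 0
      d≃ = ℚ.toℚᵘ-fromℚᵘ (mkℚᵘ d 0)

module Powers (d P Q : ℤ) where

  -- (P + Q√d) ^ s = A s + B s √d
  A B : ℕ → ℤ
  A zero    = 1ℤ
  A (suc s) = P * A s + d * (Q * B s)
  B zero    = 0ℤ
  B (suc s) = P * B s + Q * A s

  trace norm : ℤ
  trace = P + P
  norm  = P * P - d * (Q * Q)

  B≡U*Q : ∀ s → B s ≡ U trace norm s * Q
  B≡U*Q s = trans (recurrence⇒≡U* trace norm (λ s → recurrence (A s) (B s)) refl s)
                  (cong (U trace norm s *_) B₁≡Q)
    where
      recurrence : ∀ a b → P * (P * b + Q * a) + Q * (P * a + d * (Q * b))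
                         ≡ (P + P) * (P * b + Q * a) - (P * P - d * (Q * Q)) * b
      recurrence a b = solve (d ∷ P ∷ Q ∷ a ∷ b ∷ [])
      B₁≡Q : P * 0ℤ + Q * 1ℤ ≡ Q
      B₁≡Q = solve (P ∷ Q ∷ [])

  A²-dB²≡normˢ : ∀ s → A s * A s - d * (B s * B s) ≡ norm ^ s
  A²-dB²≡normˢ zero    = begin 1ℤ * 1ℤ - d * (0ℤ * 0ℤ) ≡⟨ solve (d ∷ []) ⟩ 1ℤ ∎
  A²-dB²≡normˢ (suc s) = trans (brahmagupta (A s) (B s)) (cong (norm *_) (A²-dB²≡normˢ s))
    where
      brahmagupta : ∀ a b → (P * a + d * (Q * b)) * (P * a + d * (Q * b)) - d * ((P * b + Q * a) * (P * b + Q * a))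
                          ≡ (P * P - d * (Q * Q)) * (a * a - d * (b * b))
      brahmagupta a b = solve (d ∷ P ∷ Q ∷ a ∷ b ∷ [])

  B-firstZero∈[1,2,3,4,6] : IsLeastPositive (λ s → B s ≡ 0ℤ) t → t ≡ 1 ⊎ t ≡ 2 ⊎ t ≡ 3 ⊎ t ≡ 4 ⊎ t ≡ 6
  B-firstZero∈[1,2,3,4,6] first with Q ≟ 0ℤ
  ... | yes Q≡0 = inj₁ (least-unique first (s≤s z≤n , trans (B≡U*Q 1) (cong (1ℤ *_) Q≡0) , below))
    where
      below : ∀ s → 0 ℕ.< s → s ℕ.< 1 → B s ≢ 0ℤ
      below (suc _) _ (s≤s ())
  ... | no  Q≢0 = inj₂ (firstZero∈[2,3,4,6] (least-transfer B≡0⇔U≡0 first))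
    where
      B≡0⇔U≡0 : ∀ s → B s ≡ 0ℤ ⇔ U trace norm s ≡ 0ℤ
      B≡0⇔U≡0 s = mk⇔ (i*j≡0∧j≢0⇒i≡0 Q≢0 ∘ trans (sym (B≡U*Q s)))
                       (λ U≡0 → trans (B≡U*Q s) (cong (_* Q) U≡0))

module PowerCoordinates (d : ℤ) {a b : ℚ} {P Q : ℤ} {m′ : ℕ}
                        (a≃ : toℚᵘ a ≃ mkℚᵘ P m′) (b≃ : toℚᵘ b ≃ mkℚᵘ Q m′) where
  open Field d
  open Powers d P Q

  m : ℕ
  m = suc m′

  -- mkℚᵘ X k has denominator suc k; den is chosen so that multiplying by mkℚᵘ _ m′
  -- produces den (suc s) definitionally.
  den : ℕ → ℕ
  den zero    = zero
  den (suc s) = den s ℕ.+ m′ ℕ.* suc (den s)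

  suc-den : ∀ s → suc (den s) ≡ m ℕ.^ s
  suc-den zero    = refl
  suc-den (suc s) = cong (m ℕ.*_) (suc-den s)

  power≃ : ∀ s → toℚᵘ (proj₁ ((a , b) ^K s)) ≃ mkℚᵘ (A s) (den s)
               × toℚᵘ (proj₂ ((a , b) ^K s)) ≃ mkℚᵘ (B s) (den s)
  power≃ zero    = ℚᵘ.≃-refl , ℚᵘ.≃-refl
  power≃ (suc s) = *K-≃ d a≃ b≃ (proj₁ (power≃ s)) (proj₂ (power≃ s))

  isRationalInteger-power⇔ : ∀ s → IsRationalInteger ((a , b) ^K s) ⇔ (B s ≡ 0ℤ × + (m ℕ.^ s) ∣ A s)
  isRationalInteger-power⇔ s = mk⇔
    (λ isInt → let z , A≃z , B≃0 = to (isRationalInteger⇔ d) isInt in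
       to mkℚᵘ≃integer⇔ (ℚᵘ.≃-trans (ℚᵘ.≃-sym (proj₂ (power≃ s))) B≃0) ,
       divides z (trans (to mkℚᵘ≃integer⇔ (ℚᵘ.≃-trans (ℚᵘ.≃-sym (proj₁ (power≃ s))) A≃z))
                        (cong (λ n → z * + n) (suc-den s))))
    (λ (B≡0 , divides z A≡zmˢ) → from (isRationalInteger⇔ d) (z ,
       ℚᵘ.≃-trans (proj₁ (power≃ s))
                  (from mkℚᵘ≃integer⇔ (trans A≡zmˢ (cong (λ n → z * + n) (sym (suc-den s))))) ,
       ℚᵘ.≃-trans (proj₂ (power≃ s)) (from mkℚᵘ≃integer⇔ B≡0)))
    where open Equivalence

  B≡0⇒∣A∣²≡∣norm∣ˢ : ∀ s → B s ≡ 0ℤ → ∣ A s ∣ ℕ.* ∣ A s ∣ ≡ ∣ norm ∣ ℕ.^ s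
  B≡0⇒∣A∣²≡∣norm∣ˢ s B≡0 = begin
    ∣ A s ∣ ℕ.* ∣ A s ∣              ≡⟨ abs-* (A s) (A s) ⟨
    ∣ A s * A s ∣                    ≡⟨ cong ∣_∣ (minus-zero (A s)) ⟩
    ∣ A s * A s - d * (0ℤ * 0ℤ) ∣    ≡⟨ cong (λ y → ∣ A s * A s - d * (y * y) ∣) B≡0 ⟨
    ∣ A s * A s - d * (B s * B s) ∣  ≡⟨ cong ∣_∣ (A²-dB²≡normˢ s) ⟩
    ∣ norm ^ s ∣                     ≡⟨ ∣i^n∣≡∣i∣^n norm s ⟩
    ∣ norm ∣ ℕ.^ s                   ∎
    where
      minus-zero : ∀ x → x * x ≡ x * x - d * (0ℤ * 0ℤ)
      minus-zero x = solve (d ∷ x ∷ [])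

  m*m∣norm : 0 ℕ.< t → IsRationalInteger ((a , b) ^K t) → m ℕ.* m ℕ.∣ ∣ norm ∣
  m*m∣norm {suc t} _ isInt =
    m^n∣o^n⇒m∣o t (subst₂ ℕ._∣_ (sym (^-distribʳ-* m m (suc t))) ∣A∣²≡∣norm∣ᵗ (ℕ.*-pres-∣ mᵗ∣∣A∣ mᵗ∣∣A∣))
    where
      integral : B (suc t) ≡ 0ℤ × + (m ℕ.^ suc t) ∣ A (suc t)
      integral = Equivalence.to (isRationalInteger-power⇔ (suc t)) isInt
      mᵗ∣∣A∣ : m ℕ.^ suc t ℕ.∣ ∣ A (suc t) ∣
      mᵗ∣∣A∣ = ∣⇒∣ᵤ (proj₂ integral)
      ∣A∣²≡∣norm∣ᵗ : ∣ A (suc t) ∣ ℕ.* ∣ A (suc t) ∣ ≡ ∣ norm ∣ ℕ.^ suc t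
      ∣A∣²≡∣norm∣ᵗ = B≡0⇒∣A∣²≡∣norm∣ˢ (suc t) (proj₁ integral)

  isRationalInteger-power⇔B≡0 : m ℕ.* m ℕ.∣ ∣ norm ∣ → ∀ s → IsRationalInteger ((a , b) ^K s) ⇔ B s ≡ 0ℤ
  isRationalInteger-power⇔B≡0 m²∣norm s =
    mk⇔ (proj₁ ∘ to (isRationalInteger-power⇔ s)) (λ B≡0 → from (isRationalInteger-power⇔ s) (B≡0 , mˢ∣A B≡0))
    where
      open Equivalence
      mˢ∣A : B s ≡ 0ℤ → + (m ℕ.^ s) ∣ A s
      mˢ∣A B≡0 = ∣ᵤ⇒∣ {+ (m ℕ.^ s)} {A s} (m*m∣o*o⇒m∣o
        (subst₂ ℕ._∣_ (^-distribʳ-* m m s) (sym (B≡0⇒∣A∣²≡∣norm∣ˢ s B≡0)) (^-monoˡ-∣ s m²∣norm)))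

proposition4p1 : (d : ℤ) → SquareFree d → ¬ (d ≡ + 1) → (x : K) → Field.InOK d x →
    (t : ℕ) → Field.HasExponent d x t →
    t ≡ 1 ⊎ t ≡ 2 ⊎ t ≡ 3 ⊎ t ≡ 4 ⊎ t ≡ 6
proposition4p1 d _ _ (a , b) _ t exponent@(0<t , xᵗ∈ℤ , _) with commonDenominator a b
... | P , Q , m′ , a≃ , b≃ = B-firstZero∈[1,2,3,4,6] firstZero-of-B
  where
    open Powers d P Q
    open PowerCoordinates d a≃ b≃
    firstZero-of-B : IsLeastPositive (λ s → B s ≡ 0ℤ) t
    firstZero-of-B = least-transfer (isRationalInteger-power⇔B≡0 (m*m∣norm 0<t xᵗ∈ℤ)) exponent
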